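{- Let $n\ge 2$ and let $d_1,\dots,d_n$ be positive integers with $d_n\ge d_1\ge 1$, extended periodically by $d_i=d_{i+n-1}$ for $i\ge2$. Define $s_{ -1}=b$, $s_0=a$, $s_j=s_{j-1}^{d_j}s_{j-2}$ for $j\ge1$, and let $\sigma$ be the morphism with $\sigma(a)=s_{n-1}$, $\sigma(b)=s_{n-1}^{d_n-d_1}s_{n-2}$. Then for every integer $m\ge1$, $\sigma^m(a)=s_{m(n-1)}$ and $\sigma^m(b)=s_{m(n-1)}^{d_n-d_1}s_{m(n-1)-1}$.
   Context: Words are over the alphabet $\{a,b\}$; a morphism $\psi$ satisfies $\psi(uv)=\psi(u)\psi(v)$ and is determined by its values on letters. -}

module Defs where

open import Data.Nat using (ℕ; zero; suc; _∸_)
open import Data.List using (List; []; _∷_; _++_; concatMap)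

data Letter : Set where
  a b : Letter

Word : Set
Word = List Letter

_^w_ : Word → ℕ → Word
u ^w zero = []
u ^w suc k = u ++ (u ^w k)

morph : Word → Word → Word → Word
morph ua ub = concatMap f
  where
  f : Letter → Word
  f a = ua
  f b = ub

iter : (Word → Word) → ℕ → Word → Word
iter f zero w = w
iter f (suc k) w = f (iter f k w)

-- sh d k = s_{k-1}: sh d 0 = s_{-1} = b, sh d 1 = s_0 = a,
-- sh d (j+2) = s_j = s_{j-1}^{d_j} s_{j-2}  (for j ≥ 1, i.e. index j+1 ≥ 1)
sh : (ℕ → ℕ) → ℕ → Word
sh d zero = b ∷ []
sh d (suc zero) = a ∷ []
sh d (suc (suc k)) = (sh d (suc k) ^w d (suc k)) ++ sh d k

s : (ℕ → ℕ) → ℕ → Word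
s d j = sh d (suc j)

σ : (ℕ → ℕ) → ℕ → Word → Word
σ d n = morph (s d (n ∸ 1)) ((s d (n ∸ 1) ^w (d n ∸ d 1)) ++ s d (n ∸ 2))

-- A morphism commutes with concatenation and powers, so σ acts on the
-- recurrence s_{j+2} = s_{j+1}^{d_{j+2}} s_j term by term. By (n-1)-periodicity
-- of d from index 2 on, σ therefore shifts the whole sequence by n-1 as soon as
-- it does so on s_0 and s_1: σ(s_0) = s_{n-1} by definition, and
-- σ(s_1) = s_{n-1}^{d_1} s_{n-1}^{d_n-d_1} s_{n-2} = s_n uses d_1 ≤ d_n.
-- Iterating gives σ^m(s_j) = s_{j+m(n-1)}, and σ^m(b) = σ^{m-1}(σ(b)) is then
-- computed from σ(b) = s_{n-1}^{d_n-d_1} s_{n-2}.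
module Submission where

open import Defs
open import Data.Nat using (ℕ; zero; suc; _+_; _*_; _∸_; _≤_; _≥_; s≤s; z≤n)
open import Data.Nat.Properties using (m+[n∸m]≡n; +-assoc; +-identityʳ)
open import Data.Product using (_×_; _,_)
open import Data.List using (_∷_; []; _++_)
open import Data.List.Properties using (++-assoc; ++-identityʳ; ++-identityˡ-unique)
open import Relation.Binary.PropositionalEquality using (_≡_; refl; sym; trans; cong; cong₂; module ≡-Reasoning)
open import Algebra.Morphism.Definitions Word Word _≡_ using (Homomorphic₂)

++-Homomorphic : (Word → Word) → Set
++-Homomorphic f = Homomorphic₂ f _++_ _++_

^w-+ : ∀ (u : Word) p q → (u ^w p) ++ (u ^w q) ≡ u ^w (p + q)
^w-+ u zero    q = refl
^w-+ u (suc p) q = trans (++-assoc u _ _) (cong (u ++_) (^w-+ u p q))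

morph-++ : ∀ ua ub → ++-Homomorphic (morph ua ub)
morph-++ ua ub []      v = refl
morph-++ ua ub (a ∷ u) v = trans (cong (ua ++_) (morph-++ ua ub u v)) (sym (++-assoc ua _ _))
morph-++ ua ub (b ∷ u) v = trans (cong (ub ++_) (morph-++ ua ub u v)) (sym (++-assoc ub _ _))

homomorphic-[] : ∀ f → ++-Homomorphic f → f [] ≡ []
homomorphic-[] f hom = ++-identityˡ-unique (f []) (hom [] [])

homomorphic-^w : ∀ f → ++-Homomorphic f → ∀ u k → f (u ^w k) ≡ f u ^w k
homomorphic-^w f hom u zero    = homomorphic-[] f hom
homomorphic-^w f hom u (suc k) = trans (hom u _) (cong (f u ++_) (homomorphic-^w f hom u k))

iter-homomorphic : ∀ f → ++-Homomorphic f → ∀ m → ++-Homomorphic (iter f m)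
iter-homomorphic f hom zero    u v = refl
iter-homomorphic f hom (suc m) u v = trans (cong f (iter-homomorphic f hom m u v)) (hom _ _)

iter-suc : ∀ f m w → iter f (suc m) w ≡ iter f m (f w)
iter-suc f zero    w = refl
iter-suc f (suc m) w = cong f (iter-suc f m w)

module Shift (d : ℕ → ℕ) (N : ℕ) (periodic : ∀ i → i ≥ 2 → d i ≡ d (i + N))
             (f : Word → Word) (hom : ++-Homomorphic f)
             (f-s₀ : f (s d 0) ≡ s d N) (f-s₁ : f (s d 1) ≡ s d (1 + N)) where

  shift : ∀ j → f (s d j) ≡ s d (j + N)
  shift zero          = f-s₀
  shift (suc zero)    = f-s₁
  shift (suc (suc j)) = begin
      f ((s d (suc j) ^w d (2 + j)) ++ s d j)
    ≡⟨ hom _ _ ⟩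
      f (s d (suc j) ^w d (2 + j)) ++ f (s d j)
    ≡⟨ cong₂ _++_ (trans (homomorphic-^w f hom (s d (suc j)) (d (2 + j)))
                         (cong (_^w d (2 + j)) (shift (suc j))))
                  (shift j) ⟩
      (s d (suc j + N) ^w d (2 + j)) ++ s d (j + N)
    ≡⟨ cong (λ k → (s d (suc j + N) ^w k) ++ s d (j + N)) (periodic (2 + j) (s≤s (s≤s z≤n))) ⟩
      s d (2 + j + N)
    ∎
    where open ≡-Reasoning

  iter-shift : ∀ m j → iter f m (s d j) ≡ s d (j + m * N)
  iter-shift zero    j = cong (s d) (sym (+-identityʳ j))
  iter-shift (suc m) j = begin
      iter f (suc m) (s d j)   ≡⟨ iter-suc f m _ ⟩
      iter f m (f (s d j))     ≡⟨ cong (iter f m) (shift j) ⟩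
      iter f m (s d (j + N))   ≡⟨ iter-shift m (j + N) ⟩
      s d (j + N + m * N)      ≡⟨ cong (s d) (+-assoc j N (m * N)) ⟩
      s d (j + suc m * N)      ∎
    where open ≡-Reasoning

module _ (d : ℕ → ℕ) (n' : ℕ) where

  private
    N = suc n'
    e = d (suc N) ∸ d 1

  σ-s₀ : σ d (suc N) (s d 0) ≡ s d N
  σ-s₀ = ++-identityʳ (s d N)

  σ-b : σ d (suc N) (b ∷ []) ≡ (s d N ^w e) ++ s d n'
  σ-b = ++-identityʳ _

  σ-s₁ : d 1 ≤ d (suc N) → σ d (suc N) (s d 1) ≡ s d (1 + N)
  σ-s₁ d₁≤dₙ = begin
      σ d (suc N) ((s d 0 ^w d 1) ++ (b ∷ []))
    ≡⟨ morph-++ _ _ (s d 0 ^w d 1) _ ⟩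
      σ d (suc N) (s d 0 ^w d 1) ++ σ d (suc N) (b ∷ [])
    ≡⟨ cong₂ _++_ (trans (homomorphic-^w (σ d (suc N)) (morph-++ _ _) (s d 0) (d 1))
                         (cong (_^w d 1) σ-s₀))
                  σ-b ⟩
      (s d N ^w d 1) ++ ((s d N ^w e) ++ s d n')
    ≡⟨ sym (++-assoc (s d N ^w d 1) _ _) ⟩
      ((s d N ^w d 1) ++ (s d N ^w e)) ++ s d n'
    ≡⟨ cong (_++ s d n') (trans (^w-+ (s d N) (d 1) e) (cong (s d N ^w_) (m+[n∸m]≡n d₁≤dₙ))) ⟩
      s d (1 + N)
    ∎
    where open ≡-Reasoning

module _ (d : ℕ → ℕ) (n' : ℕ)
         (periodic : ∀ i → i ≥ 2 → d i ≡ d (i + suc n')) (d₁≤dₙ : d 1 ≤ d (2 + n')) where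

  private
    N = suc n'
    e = d (suc N) ∸ d 1
    σₙ = σ d (suc N)
    hom : ++-Homomorphic σₙ
    hom = morph-++ _ _

  open Shift d N periodic σₙ hom (σ-s₀ d n') (σ-s₁ d n' d₁≤dₙ)

  iter-σ-a : ∀ m → iter σₙ m (a ∷ []) ≡ s d (m * N)
  iter-σ-a m = iter-shift m 0

  iter-σ-b : ∀ m → iter σₙ (suc m) (b ∷ []) ≡ (s d (N + m * N) ^w e) ++ s d (n' + m * N)
  iter-σ-b m = begin
      iter σₙ (suc m) (b ∷ [])                           ≡⟨ iter-suc σₙ m _ ⟩
      iter σₙ m (σₙ (b ∷ []))                            ≡⟨ cong (iter σₙ m) (σ-b d n') ⟩
      iter σₙ m ((s d N ^w e) ++ s d n')                 ≡⟨ iter-homomorphic σₙ hom m _ _ ⟩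
      iter σₙ m (s d N ^w e) ++ iter σₙ m (s d n')
        ≡⟨ cong₂ _++_ (trans (homomorphic-^w (iter σₙ m) (iter-homomorphic σₙ hom m) (s d N) e)
                             (cong (_^w e) (iter-shift m N)))
                      (iter-shift m n') ⟩
      (s d (N + m * N) ^w e) ++ s d (n' + m * N)         ∎
    where open ≡-Reasoning

corollary3p3 : (n : ℕ) → n ≥ 2 → (d : ℕ → ℕ) →
    (∀ i → 1 ≤ i → i ≤ n → d i ≥ 1) →
    d n ≥ d 1 →
    (∀ i → i ≥ 2 → d i ≡ d (i + (n ∸ 1))) →
    (m : ℕ) → m ≥ 1 →
    (iter (σ d n) m (a ∷ []) ≡ s d (m * (n ∸ 1)))
    × (iter (σ d n) m (b ∷ []) ≡ (s d (m * (n ∸ 1)) ^w (d n ∸ d 1)) ++ s d (m * (n ∸ 1) ∸ 1))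
corollary3p3 (suc (suc n')) (s≤s (s≤s z≤n)) d _ d₁≤dₙ periodic (suc m) _ =
  iter-σ-a d n' periodic d₁≤dₙ (suc m) , iter-σ-b d n' periodic d₁≤dₙ m
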